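{- Let $G$ be a graph, let $Z_1,Z_2,S\subseteq V(G)$, and let $G_1,G_2$ be induced subgraphs of $G$ with $G_1\cup G_2=G$, $V(G_1)\cap V(G_2)=S$, and $Z_i\subseteq V(G_i)$ for $i=1,2$. If $G_1$ admits a wo-decomposition from $Z_1$ to $S$, and $G_2$ admits a wo-decomposition from $S$ to $Z_2$, both of width at most some $k'$, then $G$ admits a wo-decomposition from $Z_1$ to $Z_2$ of width at most $k'$.
   Context: Graphs may be infinite. A line is a nonempty set $L$ with a linear order $\le_L$. A line-decomposition of $G$ is a pair $(L,(W_t:t\in L))$ with $L$ a line and $W_t\subseteq V(G)$, such that $G=\bigcup_{t\in L}G[W_t]$ and $W_t\cap W_{t''}\subseteq W_{t'}$ whenever $t\le_L t'\le_L t''$; its width is the maximum of $|W_t|-1$ if it exists, and $\infty$ otherwise. A line $L$ is a well-order if there is no infinite sequence of distinct elements $t_1,t_2,\dots$ with $t_{i+1}\le_L t_i$ for all $i$; a wo-decomposition is a line-decomposition whose line is a well-order. A vertex $v$ is a left-limit vertex of a line-decomposition if for all $s\le_L t$, $v\in W_t$ implies $v\in W_s$; a right-limit vertex if for all $s\le_L t$, $v\in W_s$ implies $v\in W_t$. A line-decomposition is from $Z_1$ to $Z_2$ if every vertex of $Z_1$ is a left-limit vertex and every vertex of $Z_2$ is a right-limit vertex of it. -}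

module Defs where

open import Data.Nat using (ℕ; suc; _≤_)
open import Data.List using (List; length)
open import Data.List.Membership.Propositional using (_∈_)
open import Data.Product using (Σ; ∃; _×_)
open import Data.Sum using (_⊎_)
open import Data.Empty using (⊥)
open import Data.Unit using (⊤)
open import Relation.Nullary using (¬_)
open import Relation.Binary.PropositionalEquality using (_≡_)
open import Relation.Binary.Structures using (IsTotalOrder)
open import Function.Definitions using (Injective)

record Graph : Set₁ where
  field
    V       : Set
    E       : V → V → Set
    E-sym   : ∀ {u v} → E u v → E v u
    E-irr   : ∀ {v} → ¬ E v v
open Graph public

VSet : Graph → Set₁
VSet G = V G → Set

_⊆_ : {A : Set} → (A → Set) → (A → Set) → Set
X ⊆ Y = ∀ v → X v → Y v

AtMost : {A : Set} → ℕ → (A → Set) → Set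
AtMost {A} n W = Σ (List A) λ xs → (length xs ≤ n) × (∀ v → W v → v ∈ xs)

record LineDecomposition (G : Graph) (X : VSet G) : Set₁ where
  field
    Line        : Set
    _≤L_        : Line → Line → Set
    isTotal     : IsTotalOrder _≡_ _≤L_
    nonempty    : Line
    W           : Line → V G → Set
    bag⊆        : ∀ t → W t ⊆ X
    vertexCover : ∀ v → X v → Σ Line λ t → W t v
    edgeCover   : ∀ u v → X u → X v → E G u v → Σ Line λ t → W t u × W t v
    interpol    : ∀ t t' t'' → t ≤L t' → t' ≤L t'' → ∀ v → W t v → W t'' v → W t' v
open LineDecomposition public

IsWellOrder : ∀ {G X} → LineDecomposition G X → Set
IsWellOrder D =
  ¬ (Σ (ℕ → Line D) λ f → Injective _≡_ _≡_ f × (∀ i → _≤L_ D (f (suc i)) (f i)))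

WidthAtMost : ∀ {G X} → ℕ → LineDecomposition G X → Set
WidthAtMost k D = ∀ t → AtMost (suc k) (W D t)

LeftLimit : ∀ {G X} → LineDecomposition G X → V G → Set
LeftLimit D v = ∀ s t → _≤L_ D s t → W D t v → W D s v

RightLimit : ∀ {G X} → LineDecomposition G X → V G → Set
RightLimit D v = ∀ s t → _≤L_ D s t → W D s v → W D t v

IsFromTo : ∀ {G X} → LineDecomposition G X → VSet G → VSet G → Set
IsFromTo D Z₁ Z₂ = (∀ v → Z₁ v → LeftLimit D v) × (∀ v → Z₂ v → RightLimit D v)

AdmitsWO : (G : Graph) → VSet G → VSet G → VSet G → ℕ → Set₁
AdmitsWO G X Z₁ Z₂ k =
  Σ (LineDecomposition G X) λ D → IsWellOrder D × IsFromTo D Z₁ Z₂ × WidthAtMost k D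

All : (G : Graph) → VSet G
All G _ = ⊤

{-# OPTIONS --safe #-}
-- Concatenate the two decompositions, every bag of the first before every bag
-- of the second. A vertex in bags on both sides lies in V₁ ∩ V₂ ⊆ S, hence is
-- right-limit in the first and left-limit in the second decomposition, which
-- gives the interpolation property across the junction. A vertex of Z₁ that
-- also occurs in the second decomposition is in S, so it is both left- and
-- right-limit in the first one and therefore lies in all of its bags; thus it
-- stays left-limit (symmetrically for Z₂). The ordinal sum of two well-orders
-- is a well-order, and the bags are unchanged, so the width is kept.
module Submission where

open import Defs
open import Data.Nat using (ℕ; suc; _+_)
open import Data.Nat.Properties using (+-cancelʳ-≡)
open import Data.Product using (_×_; _,_; Σ; ∃; proj₁; proj₂)
open import Data.Sum using (_⊎_; inj₁; inj₂; [_,_])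
open import Data.Sum.Relation.Binary.LeftOrder
open import Data.Sum.Relation.Binary.Pointwise using (Pointwise-≡⇒≡; ≡⇒Pointwise-≡)
open import Data.Empty using (⊥-elim)
open import Data.Unit using (tt)
open import Function using (_∘_)
open import Function.Definitions using (Injective)
open import Level using (0ℓ)
open import Relation.Binary.Core using (Rel)
open import Relation.Binary.Structures using (IsTotalOrder)
open import Relation.Binary.PropositionalEquality as ≡ using (_≡_; _≢_; refl)
open import Relation.Nullary using (¬_)

Descending : {A : Set} → Rel A 0ℓ → (ℕ → A) → Set
Descending _≤_ f = Injective _≡_ _≡_ f × (∀ i → f (suc i) ≤ f i)

NoInfiniteDescent : {A : Set} → Rel A 0ℓ → Set
NoInfiniteDescent {A} _≤_ = ¬ Σ (ℕ → A) (Descending _≤_)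

module _ {A : Set} {R : Rel A 0ℓ} where

  descending-suffix : ∀ {f} n → Descending R f → Descending R (λ i → f (i + n))
  descending-suffix n (f-inj , f↓) = +-cancelʳ-≡ n _ _ ∘ f-inj , λ i → f↓ (i + n)

module _ {A B : Set} {R : Rel A 0ℓ} {Q : Rel B 0ℓ} where

  descending-pullback : (h : A → B) → (∀ {a a′} → Q (h a) (h a′) → R a a′) →
                        ∀ {f} → (∀ i → ∃ λ a → f i ≡ h a) → Descending Q f →
                        Σ (ℕ → A) (Descending R)
  descending-pullback h reflects {f} f∈im (f-inj , f↓) = g , g-inj , g↓
    where
    g : ℕ → A
    g = proj₁ ∘ f∈im

    f≡h∘g : ∀ i → f i ≡ h (g i)
    f≡h∘g = proj₂ ∘ f∈im

    g-inj : Injective _≡_ _≡_ g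
    g-inj {i} {j} gi≡gj = f-inj (≡.trans (f≡h∘g i) (≡.trans (≡.cong h gi≡gj) (≡.sym (f≡h∘g j))))

    g↓ : ∀ i → R (g (suc i)) (g i)
    g↓ i = reflects (≡.subst₂ Q (f≡h∘g (suc i)) (f≡h∘g i) (f↓ i))

module _ {A B : Set} {R : Rel A 0ℓ} {Q : Rel B 0ℓ} where

  ⊎-<-isTotalOrder-≡ : IsTotalOrder _≡_ R → IsTotalOrder _≡_ Q → IsTotalOrder _≡_ (R ⊎-< Q)
  ⊎-<-isTotalOrder-≡ to₁ to₂ = record
    { isPartialOrder = record
      { isPreorder = record
        { isEquivalence = ≡.isEquivalence
        ; reflexive     = ⊎-<-reflexive (reflexive to₁) (reflexive to₂) ∘ ≡⇒Pointwise-≡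
        ; trans         = ⊎-<-transitive (trans to₁) (trans to₂)
        }
      ; antisym = λ x≤y y≤x → Pointwise-≡⇒≡ (⊎-<-antisymmetric (antisym to₁) (antisym to₂) x≤y y≤x)
      }
    ; total = ⊎-<-total (total to₁) (total to₂)
    }
    where open IsTotalOrder

  ⊎-<-below-inj₁ : ∀ {x a} → (R ⊎-< Q) x (inj₁ a) → ∃ λ a′ → x ≡ inj₁ a′
  ⊎-<-below-inj₁ (₁∼₁ _) = _ , refl

  ⊎-<-descent-stays-inj₁ : ∀ {f : ℕ → A ⊎ B} {a} → (∀ i → (R ⊎-< Q) (f (suc i)) (f i)) →
                           f 0 ≡ inj₁ a → ∀ i → ∃ λ a′ → f i ≡ inj₁ a′
  ⊎-<-descent-stays-inj₁ f↓ f0≡inj₁ 0 = _ , f0≡inj₁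
  ⊎-<-descent-stays-inj₁ {f} f↓ f0≡inj₁ (suc i) =
    let _ , fi≡inj₁ = ⊎-<-descent-stays-inj₁ f↓ f0≡inj₁ i
    in ⊎-<-below-inj₁ (≡.subst ((R ⊎-< Q) (f (suc i))) fi≡inj₁ (f↓ i))

  ⊎-<-noInfiniteDescent : NoInfiniteDescent R → NoInfiniteDescent Q → NoInfiniteDescent (R ⊎-< Q)
  ⊎-<-noInfiniteDescent noDescent₁ noDescent₂ (f , f↓) =
    noDescent₂ (descending-pullback {Q = R ⊎-< Q} inj₂ drop-inj₂ always-inj₂ f↓)
    where
    never-inj₁ : ∀ n a → f n ≢ inj₁ a
    never-inj₁ n a fn≡inj₁ = noDescent₁ (descending-pullback {Q = R ⊎-< Q} inj₁ drop-inj₁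
      (⊎-<-descent-stays-inj₁ (proj₂ suffix↓) fn≡inj₁) suffix↓)
      where suffix↓ = descending-suffix {R = R ⊎-< Q} n f↓

    always-inj₂ : ∀ i → ∃ λ b → f i ≡ inj₂ b
    always-inj₂ i with f i in fi≡
    ... | inj₁ a = ⊥-elim (never-inj₁ i a fi≡)
    ... | inj₂ b = b , refl

leftRightLimit⇒inAllBags : ∀ {G X} (D : LineDecomposition G X) {v t₀} →
                           LeftLimit D v → RightLimit D v → W D t₀ v → ∀ t → W D t v
leftRightLimit⇒inAllBags D {t₀ = t₀} left right v∈t₀ t with IsTotalOrder.total (isTotal D) t t₀
... | inj₁ t≤t₀ = left t t₀ t≤t₀ v∈t₀
... | inj₂ t₀≤t = right t₀ t t₀≤t v∈t₀

module Concatenation {G : Graph} {V₁ V₂ S : VSet G}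
  (D₁ : LineDecomposition G V₁) (D₂ : LineDecomposition G V₂)
  (covers : ∀ v → V₁ v ⊎ V₂ v)
  (edges : ∀ u v → E G u v → (V₁ u × V₁ v) ⊎ (V₂ u × V₂ v))
  (V₁∩V₂⊆S : ∀ v → V₁ v → V₂ v → S v)
  (S-right₁ : ∀ v → S v → RightLimit D₁ v)
  (S-left₂ : ∀ v → S v → LeftLimit D₂ v)
  where

  Index : Set
  Index = Line D₁ ⊎ Line D₂

  _≤_ : Rel Index 0ℓ
  _≤_ = _≤L_ D₁ ⊎-< _≤L_ D₂

  Bag : Index → V G → Set
  Bag = [ W D₁ , W D₂ ]

  bag₁∩V₂⊆S : ∀ {v t} → W D₁ t v → V₂ v → S v
  bag₁∩V₂⊆S {v} {t} v∈t = V₁∩V₂⊆S v (bag⊆ D₁ t v v∈t)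

  V₁∩bag₂⊆S : ∀ {v t} → V₁ v → W D₂ t v → S v
  V₁∩bag₂⊆S {v} {t} v∈V₁ v∈t = V₁∩V₂⊆S v v∈V₁ (bag⊆ D₂ t v v∈t)

  Bag-vertexCover : ∀ v → Σ Index λ t → Bag t v
  Bag-vertexCover v with covers v
  ... | inj₁ v∈V₁ = let t , v∈t = vertexCover D₁ v v∈V₁ in inj₁ t , v∈t
  ... | inj₂ v∈V₂ = let t , v∈t = vertexCover D₂ v v∈V₂ in inj₂ t , v∈t

  Bag-edgeCover : ∀ u v → E G u v → Σ Index λ t → Bag t u × Bag t v
  Bag-edgeCover u v uv with edges u v uv
  ... | inj₁ (u∈V₁ , v∈V₁) = let t , uv∈t = edgeCover D₁ u v u∈V₁ v∈V₁ uv in inj₁ t , uv∈t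
  ... | inj₂ (u∈V₂ , v∈V₂) = let t , uv∈t = edgeCover D₂ u v u∈V₂ v∈V₂ uv in inj₂ t , uv∈t

  Bag-interpol : ∀ t t′ t″ → t ≤ t′ → t′ ≤ t″ → ∀ v → Bag t v → Bag t″ v → Bag t′ v
  Bag-interpol (inj₁ t) (inj₁ t′) (inj₁ t″) (₁∼₁ t≤t′) (₁∼₁ t′≤t″) = interpol D₁ t t′ t″ t≤t′ t′≤t″
  Bag-interpol (inj₁ t) (inj₁ t′) (inj₂ t″) (₁∼₁ t≤t′) ₁∼₂ v v∈t v∈t″ =
    S-right₁ v (bag₁∩V₂⊆S v∈t (bag⊆ D₂ t″ v v∈t″)) t t′ t≤t′ v∈t
  Bag-interpol (inj₁ t) (inj₂ t′) (inj₂ t″) ₁∼₂ (₂∼₂ t′≤t″) v v∈t v∈t″ =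
    S-left₂ v (bag₁∩V₂⊆S v∈t (bag⊆ D₂ t″ v v∈t″)) t′ t″ t′≤t″ v∈t″
  Bag-interpol (inj₂ t) (inj₂ t′) (inj₂ t″) (₂∼₂ t≤t′) (₂∼₂ t′≤t″) = interpol D₂ t t′ t″ t≤t′ t′≤t″

  concatenation : LineDecomposition G (All G)
  concatenation = record
    { Line        = Index
    ; _≤L_        = _≤_
    ; isTotal     = ⊎-<-isTotalOrder-≡ (isTotal D₁) (isTotal D₂)
    ; nonempty    = inj₁ (nonempty D₁)
    ; W           = Bag
    ; bag⊆        = λ _ _ _ → tt
    ; vertexCover = λ v _ → Bag-vertexCover v
    ; edgeCover   = λ u v _ _ → Bag-edgeCover u v
    ; interpol    = Bag-interpol
    }

  concatenation-isWellOrder : IsWellOrder D₁ → IsWellOrder D₂ → IsWellOrder concatenation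
  concatenation-isWellOrder = ⊎-<-noInfiniteDescent

  concatenation-width : ∀ {k} → WidthAtMost k D₁ → WidthAtMost k D₂ → WidthAtMost k concatenation
  concatenation-width width₁ width₂ (inj₁ t) = width₁ t
  concatenation-width width₁ width₂ (inj₂ t) = width₂ t

  concatenation-leftLimit : ∀ v → V₁ v → LeftLimit D₁ v → LeftLimit concatenation v
  concatenation-leftLimit v v∈V₁ left (inj₁ s) (inj₁ t) (₁∼₁ s≤t) v∈t = left s t s≤t v∈t
  concatenation-leftLimit v v∈V₁ left (inj₁ s) (inj₂ t) ₁∼₂ v∈t =
    let t₀ , v∈t₀ = vertexCover D₁ v v∈V₁
    in leftRightLimit⇒inAllBags D₁ left (S-right₁ v (V₁∩bag₂⊆S v∈V₁ v∈t)) v∈t₀ s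
  concatenation-leftLimit v v∈V₁ left (inj₂ s) (inj₂ t) (₂∼₂ s≤t) v∈t =
    S-left₂ v (V₁∩bag₂⊆S v∈V₁ v∈t) s t s≤t v∈t

  concatenation-rightLimit : ∀ v → V₂ v → RightLimit D₂ v → RightLimit concatenation v
  concatenation-rightLimit v v∈V₂ right (inj₁ s) (inj₁ t) (₁∼₁ s≤t) v∈s =
    S-right₁ v (bag₁∩V₂⊆S v∈s v∈V₂) s t s≤t v∈s
  concatenation-rightLimit v v∈V₂ right (inj₁ s) (inj₂ t) ₁∼₂ v∈s =
    let t₀ , v∈t₀ = vertexCover D₂ v v∈V₂
    in leftRightLimit⇒inAllBags D₂ (S-left₂ v (bag₁∩V₂⊆S v∈s v∈V₂)) right v∈t₀ t
  concatenation-rightLimit v v∈V₂ right (inj₂ s) (inj₂ t) (₂∼₂ s≤t) v∈s = right s t s≤t v∈s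

mainTheorem8 : (G : Graph) (Z₁ Z₂ S V₁ V₂ : VSet G) (k′ : ℕ) →
    (∀ v → V₁ v ⊎ V₂ v) →
    (∀ u v → E G u v → (V₁ u × V₁ v) ⊎ (V₂ u × V₂ v)) →
    (∀ v → V₁ v → V₂ v → S v) →
    (∀ v → S v → V₁ v × V₂ v) →
    Z₁ ⊆ V₁ → Z₂ ⊆ V₂ →
    AdmitsWO G V₁ Z₁ S k′ →
    AdmitsWO G V₂ S Z₂ k′ →
    AdmitsWO G (All G) Z₁ Z₂ k′
mainTheorem8 G Z₁ Z₂ S V₁ V₂ k′ covers edges V₁∩V₂⊆S _ Z₁⊆V₁ Z₂⊆V₂
  (D₁ , wo₁ , (Z₁-left , S-right) , width₁) (D₂ , wo₂ , (S-left , Z₂-right) , width₂) =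
  concatenation ,
  concatenation-isWellOrder wo₁ wo₂ ,
  ( (λ v z → concatenation-leftLimit v (Z₁⊆V₁ v z) (Z₁-left v z))
  , (λ v z → concatenation-rightLimit v (Z₂⊆V₂ v z) (Z₂-right v z)) ) ,
  concatenation-width width₁ width₂
  where open Concatenation D₁ D₂ covers edges V₁∩V₂⊆S S-right S-left
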